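{- Let $i,j$ be integers with $0\leq j\leq i$, and let $O(i,j)=\biguplus_{k=0}^{j} O(i,j,k)$ be the set of weighted overpartitions defined in the context. Then \[ \sum_{k=0}^{j}(q^{i-k+1};q)_k\,{j\brack k}\, q^{(i-k)(j-k)}=\sum_{\lambda\in O(i,j)}(-1)^{ol(\lambda)}\,q^{|\lambda|+ol(\lambda)w(\lambda)}\,q^{(i-\ell(\lambda))(j-\ell(\lambda))}. \]
   Context: Notation: $(a;q)_k=(1-a)(1-aq)\cdots(1-aq^{k-1})$ for $k>0$ and $(a;q)_0=1$; ${j\brack k}=\frac{(q;q)_j}{(q;q)_k(q;q)_{j-k}}$ is the Gaussian ($q$-binomial) coefficient. A partition with $k$ parts is a vector $\lambda=(\lambda_1,\dots,\lambda_k)$ of integers with $\lambda_1\geq\cdots\geq\lambda_k\geq 0$ (zero parts are allowed and counted); its length $\ell(\lambda)=k$ is the number of (nonnegative) parts, and its size is $|\lambda|=\sum_s\lambda_s$. An overpartition is such a partition in which the first occurrence of each value (including the value $0$) may be overlined; $ol(\lambda)$ denotes the number of overlined parts. For $0\leq k\leq j\leq i$, $O(i,j,k)$ is the set of overpartitions $\lambda$ with exactly $k$ nonnegative parts such that: (1) every part is at most $j-1$; (2) if $k\geq 2$, then for each $1\leq s\leq k-1$ such that $j-s$ occurs as a part of $\lambda$, there are at least $k-s$ overlined parts to the right of $j-s$ (i.e. at least $k-s$ overlined parts of value strictly less than $j-s$); (3) each overlined part carries the weight $w(\lambda)=i-k+1$. The empty partition (with $\ell=0$, $ol=0$, size $0$)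 is the unique element of $O(i,j,0)$. -}

module Defs where

open import Data.Nat as ℕ using (ℕ; zero; suc; _∸_; _≤ᵇ_; _≡ᵇ_; _<ᵇ_)
open import Data.Integer using (ℤ; _+_; _*_; _-_; _^_; 0ℤ; 1ℤ; -1ℤ)
open import Data.Bool using (Bool; true; false; _∧_; _∨_; not; if_then_else_)
open import Data.Product using (_×_; _,_; proj₁; proj₂)
open import Data.List using (List; []; _∷_; map; concatMap; upTo; foldr; length)

sumℤ : List ℤ → ℤ
sumℤ = foldr _+_ 0ℤ

sumTo : ℕ → (ℕ → ℤ) → ℤ
sumTo n f = sumℤ (map f (upTo (suc n)))

-- q-Pochhammer symbol (a;q)_k, evaluated at an integer q
poch : ℤ → ℤ → ℕ → ℤ
poch a q zero    = 1ℤ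
poch a q (suc k) = poch a q k * (1ℤ - a * q ^ k)

gauss : ℤ → ℕ → ℕ → ℤ
gauss q j       zero    = 1ℤ
gauss q zero    (suc k) = 0ℤ
gauss q (suc j) (suc k) = gauss q j k + q ^ suc k * gauss q j (suc k)

-- An overpartition with k parts: the parts listed left to right
-- (λ₁, …, λ_k), each with a flag telling whether it is overlined.
OverPart : Set
OverPart = List (ℕ × Bool)

size : OverPart → ℕ
size = foldr (λ p n → proj₁ p ℕ.+ n) 0

ol : OverPart → ℕ
ol = foldr (λ p n → if proj₂ p then suc n else n) 0

-- all candidate lists of length k with parts in {0,…,j-1} (condition (1)),
-- each part overlined or not
choices : ℕ → List (ℕ × Bool)
choices j = concatMap (λ v → (v , false) ∷ (v , true) ∷ []) (upTo j)

words : ℕ → List (ℕ × Bool) → List OverPart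
words zero    xs = [] ∷ []
words (suc k) xs = concatMap (λ x → map (x ∷_) (words k xs)) xs

-- λ₁ ≥ λ₂ ≥ … and only the first (leftmost) occurrence of a value may be overlined
isOverpartition : OverPart → Bool
isOverpartition [] = true
isOverpartition (p ∷ []) = true
isOverpartition ((a , x) ∷ (b , y) ∷ rest) =
  (b ≤ᵇ a) ∧ (not (a ≡ᵇ b) ∨ not y) ∧ isOverpartition ((b , y) ∷ rest)

anyᵇ : {A : Set} → (A → Bool) → List A → Bool
anyᵇ p = foldr (λ x b → p x ∨ b) false

allᵇ : {A : Set} → (A → Bool) → List A → Bool
allᵇ p = foldr (λ x b → p x ∧ b) true

occurs : ℕ → OverPart → Bool
occurs v = anyᵇ (λ p → proj₁ p ≡ᵇ v)

olBelow : ℕ → OverPart → ℕ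
olBelow v = foldr (λ p n → if proj₂ p ∧ (proj₁ p <ᵇ v) then suc n else n) 0

cond2 : ℕ → ℕ → OverPart → Bool
cond2 j k lam =
  allᵇ (λ s → not ((1 ≤ᵇ s) ∧ occurs (j ∸ s) lam) ∨ ((k ∸ s) ≤ᵇ olBelow (j ∸ s) lam))
      (upTo k)

-- membership in O(i,j,k) (does not depend on i); length k is by construction
inO : ℕ → ℕ → OverPart → Bool
inO j k lam = isOverpartition lam ∧ cond2 j k lam

sumO : ℕ → ℕ → (OverPart → ℤ) → ℤ
sumO j k F = sumℤ (map (λ lam → if inO j k lam then F lam else 0ℤ) (words k (choices j)))

weight : ℕ → ℕ → ℕ
weight i k = suc (i ∸ k)

LHS : ℕ → ℕ → ℤ → ℤ
LHS i j q = sumTo j (λ k →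
  poch (q ^ (suc (i ∸ k))) q k * gauss q j k * q ^ ((i ∸ k) ℕ.* (j ∸ k)))

RHS : ℕ → ℕ → ℤ → ℤ
RHS i j q = sumTo j (λ k → sumO j k (λ lam →
  (-1ℤ ^ ol lam) * q ^ (size lam ℕ.+ ol lam ℕ.* weight i k)
    * q ^ ((i ∸ length lam) ℕ.* (j ∸ length lam))))

module Submission where

-- The identity is proved summand by summand in k.  Put j = k + d and
-- W = i - k + 1.  Every λ ∈ O(i,j,k) has length k, so the k-th summand on the
-- right is q^((i-k)(j-k)) times the signed sum Σ (-1)^ol(λ) q^(|λ| + ol(λ)·W),
-- and it remains to identify that sum with (q^W;q)_k [j k].
--
-- Read an overpartition from its smallest part upwards.  Condition (2) then
-- says that every part v has at least v - d overlined parts below it, and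
-- together with the ordering it becomes a "staircase" condition: with a lower
-- bound m (initially 0) and an upper bound d, each part v must satisfy
-- m ≤ v ≤ d; a plain part moves the lower bound to v, an overlined part moves
-- the lower bound to v + 1 and the upper bound to d + 1.  The weighted sum
-- S k d m over staircase words of length k satisfies a first-part recursion,
-- which is solved by q^(k·m) (q^W;q)_k [k + d - m, k] by induction on k and
-- the q-analogue of the hockey-stick identity.

open import Defs
open import Data.Nat as ℕ using (ℕ; zero; suc; _∸_; _≤ᵇ_; _≡ᵇ_; _<ᵇ_; _≤_; _<_; z≤n; s≤s)
import Data.Nat.Properties as ℕₚ
import Data.Nat.Tactic.RingSolver as ℕ-Solver
open import Data.Integer using (ℤ; _+_; _*_; _-_; _^_; 0ℤ; 1ℤ; -1ℤ)
open import Data.Integer.Properties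
  using (+-assoc; +-identityˡ; +-identityʳ; *-comm; *-identityˡ; *-zeroʳ; *-distribˡ-+; ^-distribˡ-+-*)
open import Data.Integer.Tactic.RingSolver using (solve-∀)
open import Data.Bool using (Bool; true; false; _∧_; _∨_; not; if_then_else_; T)
open import Data.Bool.Properties using (T-∧; T-∨; T-≡; ∧-assoc; ∧-comm; ∧-identityʳ)
open import Data.Unit using (tt)
open import Data.Empty using (⊥-elim)
open import Data.Sum using (_⊎_; inj₁; inj₂)
open import Function.Bundles using (Equivalence)
open import Relation.Nullary using (¬_; yes; no)
open import Relation.Nullary.Decidable using (T?)
open import Data.Product using (Σ; _×_; _,_; proj₁; proj₂)
open import Data.List using (List; []; _∷_; _++_; [_]; map; concatMap; upTo; length; reverse)
open import Data.List.Properties using (map-++; map-upTo; unfold-reverse; ++-assoc)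
open import Data.List.Relation.Binary.Permutation.Propositional as Perm using (_↭_; ↭-sym)
open import Data.List.Relation.Binary.Permutation.Propositional.Properties using (↭-reverse; All-resp-↭)
open import Data.List.Relation.Unary.All as All using (All; []; _∷_)
open import Data.List.Relation.Unary.All.Properties using (concat⁺; map⁺; applyUpTo⁺₁; applyUpTo⁻; all-upTo)
open import Relation.Binary.PropositionalEquality using (_≡_; refl; sym; trans; cong; cong₂; subst; module ≡-Reasoning)

sumOver : {A : Set} → List A → (A → ℤ) → ℤ
sumOver xs f = sumℤ (map f xs)

sumℤ-++ : (xs ys : List ℤ) → sumℤ (xs ++ ys) ≡ sumℤ xs + sumℤ ys
sumℤ-++ []       ys = sym (+-identityˡ (sumℤ ys))
sumℤ-++ (x ∷ xs) ys = trans (cong (x +_) (sumℤ-++ xs ys)) (sym (+-assoc x (sumℤ xs) (sumℤ ys)))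

sumOver-++ : {A : Set} (xs ys : List A) (f : A → ℤ) →
  sumOver (xs ++ ys) f ≡ sumOver xs f + sumOver ys f
sumOver-++ xs ys f = trans (cong sumℤ (map-++ f xs ys)) (sumℤ-++ (map f xs) (map f ys))

sumOver-concatMap : {A B : Set} (g : A → List B) (xs : List A) (f : B → ℤ) →
  sumOver (concatMap g xs) f ≡ sumOver xs (λ x → sumOver (g x) f)
sumOver-concatMap g []       f = refl
sumOver-concatMap g (x ∷ xs) f =
  trans (sumOver-++ (g x) (concatMap g xs) f) (cong (sumOver (g x) f +_) (sumOver-concatMap g xs f))

sumOver-map : {A B : Set} (h : A → B) (xs : List A) (f : B → ℤ) →
  sumOver (map h xs) f ≡ sumOver xs (λ x → f (h x))
sumOver-map h []       f = refl
sumOver-map h (x ∷ xs) f = cong (f (h x) +_) (sumOver-map h xs f)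

sumOver-cong : {A : Set} (xs : List A) {f g : A → ℤ} → (∀ x → f x ≡ g x) → sumOver xs f ≡ sumOver xs g
sumOver-cong []       f≗g = refl
sumOver-cong (x ∷ xs) f≗g = cong₂ _+_ (f≗g x) (sumOver-cong xs f≗g)

sumOver-congᴬ : {A : Set} {P : A → Set} (xs : List A) {f g : A → ℤ} →
  All P xs → (∀ x → P x → f x ≡ g x) → sumOver xs f ≡ sumOver xs g
sumOver-congᴬ []       []         f≗g = refl
sumOver-congᴬ (x ∷ xs) (px ∷ pxs) f≗g = cong₂ _+_ (f≗g x px) (sumOver-congᴬ xs pxs f≗g)

sumOver-+ : {A : Set} (xs : List A) (f g : A → ℤ) →
  sumOver xs (λ x → f x + g x) ≡ sumOver xs f + sumOver xs g
sumOver-+ []       f g = refl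
sumOver-+ (x ∷ xs) f g =
  trans (cong (f x + g x +_) (sumOver-+ xs f g)) (interchange (f x) (g x) (sumOver xs f) (sumOver xs g))
  where
  interchange : ∀ a b c d → a + b + (c + d) ≡ a + c + (b + d)
  interchange = solve-∀

sumOver-scale : {A : Set} (xs : List A) (c : ℤ) (f : A → ℤ) →
  sumOver xs (λ x → c * f x) ≡ c * sumOver xs f
sumOver-scale []       c f = sym (*-zeroʳ c)
sumOver-scale (x ∷ xs) c f =
  trans (cong (c * f x +_) (sumOver-scale xs c f)) (sym (*-distribˡ-+ c (f x) (sumOver xs f)))

sumOver-zero : {A : Set} (xs : List A) → sumOver xs (λ _ → 0ℤ) ≡ 0ℤ
sumOver-zero []       = refl
sumOver-zero (x ∷ xs) = trans (+-identityˡ _) (sumOver-zero xs)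

sumOver-swap : {A B : Set} (xs : List A) (ys : List B) (F : A → B → ℤ) →
  sumOver xs (λ x → sumOver ys (F x)) ≡ sumOver ys (λ y → sumOver xs (λ x → F x y))
sumOver-swap []       ys F = sym (sumOver-zero ys)
sumOver-swap (x ∷ xs) ys F =
  trans (cong (sumOver ys (F x) +_) (sumOver-swap xs ys F)) (sym (sumOver-+ ys (F x) _))

sumOver-guard : {A : Set} (xs : List A) (g : Bool) (r : A → Bool) (c : ℤ) (f : A → ℤ) →
  sumOver xs (λ x → if g ∧ r x then c * f x else 0ℤ) ≡ (if g then c * sumOver xs (λ x → if r x then f x else 0ℤ) else 0ℤ)
sumOver-guard xs true  r c f = trans (sumOver-cong xs pull) (sumOver-scale xs c _)
  where
  pull : ∀ x → (if r x then c * f x else 0ℤ) ≡ c * (if r x then f x else 0ℤ)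
  pull x with r x
  ... | true  = refl
  ... | false = sym (*-zeroʳ c)
sumOver-guard xs false r c f = sumOver-zero xs

sumWords : ℕ → List (ℕ × Bool) → (OverPart → ℤ) → ℤ
sumWords k xs f = sumOver (words k xs) f

sumWords-head : (k : ℕ) (xs : List (ℕ × Bool)) (f : OverPart → ℤ) →
  sumWords (suc k) xs f ≡ sumOver xs (λ x → sumWords k xs (λ u → f (x ∷ u)))
sumWords-head k xs f =
  trans (sumOver-concatMap _ xs f) (sumOver-cong xs (λ x → sumOver-map (x ∷_) (words k xs) f))

sumWords-last : (k : ℕ) (xs : List (ℕ × Bool)) (f : OverPart → ℤ) →
  sumWords (suc k) xs f ≡ sumWords k xs (λ u → sumOver xs (λ x → f (u ++ [ x ])))
sumWords-last zero    xs f =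
  trans (sumWords-head zero xs f)
        (trans (sumOver-cong xs (λ x → +-identityʳ (f [ x ]))) (sym (+-identityʳ _)))
sumWords-last (suc k) xs f = begin
  sumWords (suc (suc k)) xs f
    ≡⟨ sumWords-head (suc k) xs f ⟩
  sumOver xs (λ x → sumWords (suc k) xs (λ u → f (x ∷ u)))
    ≡⟨ sumOver-cong xs (λ x → sumWords-last k xs (λ u → f (x ∷ u))) ⟩
  sumOver xs (λ x → sumWords k xs (λ u → sumOver xs (λ y → f (x ∷ u ++ [ y ]))))
    ≡⟨ sym (sumWords-head k xs _) ⟩
  sumWords (suc k) xs (λ u → sumOver xs (λ y → f (u ++ [ y ]))) ∎
  where open ≡-Reasoning

-- Reversal permutes the words of a given length.
sumWords-reverse : (k : ℕ) (xs : List (ℕ × Bool)) (f : OverPart → ℤ) →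
  sumWords k xs (λ u → f (reverse u)) ≡ sumWords k xs f
sumWords-reverse zero    xs f = refl
sumWords-reverse (suc k) xs f = begin
  sumWords (suc k) xs (λ u → f (reverse u))
    ≡⟨ sumWords-head k xs _ ⟩
  sumOver xs (λ x → sumWords k xs (λ u → f (reverse (x ∷ u))))
    ≡⟨ sumOver-cong xs (λ x → sumOver-cong (words k xs) (λ u → cong f (unfold-reverse x u))) ⟩
  sumOver xs (λ x → sumWords k xs (λ u → f (reverse u ++ [ x ])))
    ≡⟨ sumOver-cong xs (λ x → sumWords-reverse k xs (λ u → f (u ++ [ x ]))) ⟩
  sumOver xs (λ x → sumWords k xs (λ u → f (u ++ [ x ])))
    ≡⟨ sumOver-swap xs (words k xs) _ ⟩
  sumWords k xs (λ u → sumOver xs (λ x → f (u ++ [ x ])))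
    ≡⟨ sym (sumWords-last k xs f) ⟩
  sumWords (suc k) xs f ∎
  where open ≡-Reasoning

words-shape : {P : ℕ × Bool → Set} (k : ℕ) (xs : List (ℕ × Bool)) →
  All P xs → All (λ w → length w ≡ k × All P w) (words k xs)
words-shape zero    xs pxs = (refl , []) ∷ []
words-shape {P} (suc k) xs pxs = concat⁺ (map⁺ (All.map extend pxs))
  where
  extend : ∀ {x} → P x → All (λ w → length w ≡ suc k × All P w) (map (x ∷_) (words k xs))
  extend px = map⁺ (All.map (λ { (len , pw) → cong suc len , px ∷ pw }) (words-shape k xs pxs))

∧-elim : ∀ {a b} → T (a ∧ b) → T a × T b
∧-elim {a} = Equivalence.to (T-∧ {a})

∧-intro : ∀ {a b} → T a → T b → T (a ∧ b)
∧-intro ta tb = Equivalence.from T-∧ (ta , tb)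

∨-elim : ∀ {a b} → T (a ∨ b) → T a ⊎ T b
∨-elim {a} = Equivalence.to (T-∨ {a})

∨-introˡ : ∀ {a b} → T a → T (a ∨ b)
∨-introˡ ta = Equivalence.from T-∨ (inj₁ ta)

∨-introʳ : ∀ {a b} → T b → T (a ∨ b)
∨-introʳ {a} tb = Equivalence.from (T-∨ {a}) (inj₂ tb)

not-intro : ∀ {a} → ¬ T a → T (not a)
not-intro {true}  ¬ta = ¬ta tt
not-intro {false} _   = tt

not-elim : ∀ {a} → T (not a) → ¬ T a
not-elim {true} ()

T-ext : ∀ {a b} → (T a → T b) → (T b → T a) → a ≡ b
T-ext {true}  {true}  _ _ = refl
T-ext {true}  {false} f _ = ⊥-elim (f tt)
T-ext {false} {true}  _ g = ⊥-elim (g tt)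
T-ext {false} {false} _ _ = refl

gauss-above : (q : ℤ) (n r : ℕ) → gauss q n (n ℕ.+ suc r) ≡ 0ℤ
gauss-above q zero    r = refl
gauss-above q (suc n) r = begin
  gauss q n (n ℕ.+ suc r) + q ^ suc (n ℕ.+ suc r) * gauss q n (suc (n ℕ.+ suc r))
    ≡⟨ cong₂ (λ x y → x + q ^ suc (n ℕ.+ suc r) * y)
             (gauss-above q n r)
             (trans (cong (gauss q n) (sym (ℕₚ.+-suc n (suc r)))) (gauss-above q n (suc r))) ⟩
  0ℤ + q ^ suc (n ℕ.+ suc r) * 0ℤ
    ≡⟨ trans (+-identityˡ _) (*-zeroʳ (q ^ suc (n ℕ.+ suc r))) ⟩
  0ℤ ∎
  where open ≡-Reasoning

gauss-diagonal : (q : ℤ) (n : ℕ) → gauss q n n ≡ 1ℤ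
gauss-diagonal q zero    = refl
gauss-diagonal q (suc n) = begin
  gauss q n n + q ^ suc n * gauss q n (suc n)
    ≡⟨ cong₂ (λ x y → x + q ^ suc n * y)
             (gauss-diagonal q n)
             (trans (cong (gauss q n) (ℕₚ.+-comm 1 n)) (gauss-above q n 0)) ⟩
  1ℤ + q ^ suc n * 0ℤ
    ≡⟨ cong (1ℤ +_) (*-zeroʳ (q ^ suc n)) ⟩
  1ℤ ∎
  where open ≡-Reasoning

intervalSum : (ℕ → ℤ) → ℕ → ℕ → ℤ
intervalSum H m zero    = H m
intervalSum H m (suc e) = H m + intervalSum H (suc m) e

intervalSum-shift : (H : ℕ → ℤ) (m e : ℕ) → intervalSum (λ v → H (suc v)) m e ≡ intervalSum H (suc m) e
intervalSum-shift H m zero    = refl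
intervalSum-shift H m (suc e) = cong (H (suc m) +_) (intervalSum-shift H (suc m) e)

intervalSum-scale : (c : ℤ) (H : ℕ → ℤ) (m e : ℕ) →
  intervalSum (λ v → c * H v) m e ≡ c * intervalSum H m e
intervalSum-scale c H m zero    = refl
intervalSum-scale c H m (suc e) =
  trans (cong (c * H m +_) (intervalSum-scale c H (suc m) e)) (sym (*-distribˡ-+ c (H m) _))

-- The q-hockey-stick identity
--   Σ_{v=m}^{m+e} q^((k+1)v) [k + (m + e - v), k] = q^((k+1)m) [k + 1 + e, k + 1],
-- obtained by unfolding the q-Pascal rule of the last coefficient e times.
hockeyStick : (q : ℤ) (k D e m : ℕ) → m ℕ.+ e ≡ D →
  intervalSum (λ v → q ^ (suc k ℕ.* v) * gauss q (k ℕ.+ (D ∸ v)) k) m e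
    ≡ q ^ (suc k ℕ.* m) * gauss q (suc k ℕ.+ e) (suc k)
hockeyStick q k .(m ℕ.+ zero) zero m refl = cong (q ^ (suc k ℕ.* m) *_) (begin
  gauss q (k ℕ.+ (m ℕ.+ 0 ∸ m)) k    ≡⟨ cong (λ z → gauss q (k ℕ.+ z) k) (ℕₚ.m+n∸m≡n m 0) ⟩
  gauss q (k ℕ.+ 0) k                 ≡⟨ cong (λ z → gauss q z k) (ℕₚ.+-identityʳ k) ⟩
  gauss q k k                         ≡⟨ gauss-diagonal q k ⟩
  1ℤ                                  ≡⟨ sym (gauss-diagonal q (suc k)) ⟩
  gauss q (suc k) (suc k)             ≡⟨ cong (λ z → gauss q z (suc k)) (sym (ℕₚ.+-identityʳ (suc k))) ⟩
  gauss q (suc k ℕ.+ 0) (suc k)       ∎)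
  where open ≡-Reasoning
hockeyStick q k .(m ℕ.+ suc e) (suc e) m refl = begin
  X * gauss q (k ℕ.+ (m ℕ.+ suc e ∸ m)) k + intervalSum _ (suc m) e
    ≡⟨ cong₂ _+_ (cong (λ z → X * gauss q (k ℕ.+ z) k) (ℕₚ.m+n∸m≡n m (suc e)))
                 (hockeyStick q k (m ℕ.+ suc e) e (suc m) (sym (ℕₚ.+-suc m e))) ⟩
  X * gauss q (k ℕ.+ suc e) k + q ^ (suc k ℕ.* suc m) * gauss q (suc k ℕ.+ e) (suc k)
    ≡⟨ cong₂ (λ x y → X * gauss q (k ℕ.+ suc e) k + x * gauss q y (suc k))
             (trans (cong (q ^_) (ℕₚ.*-suc (suc k) m)) (^-distribˡ-+-* q (suc k) (suc k ℕ.* m)))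
             (sym (ℕₚ.+-suc k e)) ⟩
  X * gauss q (k ℕ.+ suc e) k + q ^ suc k * X * gauss q (k ℕ.+ suc e) (suc k)
    ≡⟨ factor X (gauss q (k ℕ.+ suc e) k) (q ^ suc k) (gauss q (k ℕ.+ suc e) (suc k)) ⟩
  X * gauss q (suc k ℕ.+ suc e) (suc k) ∎
  where
  open ≡-Reasoning
  X : ℤ
  X = q ^ (suc k ℕ.* m)
  factor : ∀ x g c h → x * g + c * x * h ≡ x * (g + c * h)
  factor = solve-∀

inRange : ℕ → ℕ → ℕ → Bool
inRange m D v = (m ≤ᵇ v) ∧ (v ≤ᵇ D)

inRange-elim : ∀ {m d v} → T (inRange m d v) → m ≤ v × v ≤ d
inRange-elim {m} {d} {v} h with ∧-elim {m ≤ᵇ v} h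
... | m≤v , v≤d = ℕₚ.≤ᵇ⇒≤ m v m≤v , ℕₚ.≤ᵇ⇒≤ v d v≤d

inRange-intro : ∀ {m d v} → m ≤ v → v ≤ d → T (inRange m d v)
inRange-intro m≤v v≤d = ∧-intro (ℕₚ.≤⇒≤ᵇ m≤v) (ℕₚ.≤⇒≤ᵇ v≤d)

sumUpTo-suc : (n : ℕ) (f : ℕ → ℤ) → sumOver (upTo (suc n)) f ≡ f 0 + sumOver (upTo n) (λ v → f (suc v))
sumUpTo-suc n f =
  trans (cong sumℤ (map-upTo f (suc n))) (cong (f 0 +_) (sym (cong sumℤ (map-upTo (λ v → f (suc v)) n))))

≤ᵇ-suc : (x y : ℕ) → (suc x ≤ᵇ suc y) ≡ (x ≤ᵇ y)
≤ᵇ-suc zero    y = refl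
≤ᵇ-suc (suc x) y = refl

sumUpTo-inRange : (n m e : ℕ) (H : ℕ → ℤ) → m ℕ.+ e < n →
  sumOver (upTo n) (λ v → if inRange m (m ℕ.+ e) v then H v else 0ℤ) ≡ intervalSum H m e
sumUpTo-inRange (suc n) zero zero H _ = begin
  sumOver (upTo (suc n)) (λ v → if inRange 0 0 v then H v else 0ℤ)
    ≡⟨ sumUpTo-suc n (λ v → if inRange 0 0 v then H v else 0ℤ) ⟩
  H 0 + sumOver (upTo n) (λ _ → 0ℤ)
    ≡⟨ trans (cong (H 0 +_) (sumOver-zero (upTo n))) (+-identityʳ (H 0)) ⟩
  H 0 ∎
  where open ≡-Reasoning
sumUpTo-inRange (suc n) zero (suc e) H (s≤s e<n) = begin
  sumOver (upTo (suc n)) (λ v → if inRange 0 (suc e) v then H v else 0ℤ)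
    ≡⟨ sumUpTo-suc n (λ v → if inRange 0 (suc e) v then H v else 0ℤ) ⟩
  H 0 + sumOver (upTo n) (λ v → if suc v ≤ᵇ suc e then H (suc v) else 0ℤ)
    ≡⟨ cong (H 0 +_) (sumOver-cong (upTo n) (λ v → cong (λ b → if b then H (suc v) else 0ℤ) (≤ᵇ-suc v e))) ⟩
  H 0 + sumOver (upTo n) (λ v → if inRange 0 e v then H (suc v) else 0ℤ)
    ≡⟨ cong (H 0 +_) (trans (sumUpTo-inRange n zero e (λ v → H (suc v)) e<n) (intervalSum-shift H 0 e)) ⟩
  H 0 + intervalSum H 1 e ∎
  where open ≡-Reasoning
sumUpTo-inRange (suc n) (suc m) e H (s≤s m+e<n) = begin
  sumOver (upTo (suc n)) (λ v → if inRange (suc m) (suc m ℕ.+ e) v then H v else 0ℤ)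
    ≡⟨ trans (sumUpTo-suc n (λ v → if inRange (suc m) (suc m ℕ.+ e) v then H v else 0ℤ)) (+-identityˡ _) ⟩
  sumOver (upTo n) (λ v → if inRange (suc m) (suc m ℕ.+ e) (suc v) then H (suc v) else 0ℤ)
    ≡⟨ sumOver-cong (upTo n) (λ v → cong (λ b → if b then H (suc v) else 0ℤ)
                                         (cong₂ _∧_ (≤ᵇ-suc m v) (≤ᵇ-suc v (m ℕ.+ e)))) ⟩
  sumOver (upTo n) (λ v → if inRange m (m ℕ.+ e) v then H (suc v) else 0ℤ)
    ≡⟨ trans (sumUpTo-inRange n m e (λ v → H (suc v)) m+e<n) (intervalSum-shift H m e) ⟩
  intervalSum H (suc m) e ∎
  where open ≡-Reasoning

isOverpartitionAsc : OverPart → Bool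
isOverpartitionAsc []                          = true
isOverpartitionAsc (p ∷ [])                    = true
isOverpartitionAsc ((a , x) ∷ (b , y) ∷ rest) =
  (a ≤ᵇ b) ∧ (not (a ≡ᵇ b) ∨ not x) ∧ isOverpartitionAsc ((b , y) ∷ rest)

AllAtLeast : ℕ → OverPart → Set
AllAtLeast m w = All (λ p → m ≤ proj₁ p) w

-- Every part v has at least v - d overlined parts of smaller value: this is
-- condition (2) of O(i, k + d, k) for words with parts below k + d (see
-- `EnoughBelow⇒cond2` and `cond2⇒EnoughBelow`).
EnoughBelow : ℕ → OverPart → Set
EnoughBelow d w = All (λ p → proj₁ p ∸ d ≤ olBelow (proj₁ p) w) w

staircase : ℕ → ℕ → OverPart → Bool
staircase d m []               = true
staircase d m ((v , false) ∷ t) = inRange m d v ∧ staircase d v t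
staircase d m ((v , true)  ∷ t) = inRange m d v ∧ staircase (suc d) (suc v) t

Staircase : ℕ → ℕ → OverPart → Set
Staircase d m w = AllAtLeast m w × T (isOverpartitionAsc w) × EnoughBelow d w

isOverpartitionAsc-tail : ∀ x t → T (isOverpartitionAsc (x ∷ t)) → T (isOverpartitionAsc t)
isOverpartitionAsc-tail x       []      _ = tt
isOverpartitionAsc-tail (a , x) (_ ∷ t) h = proj₂ (∧-elim {not (a ≡ᵇ _) ∨ not x} (proj₂ (∧-elim {a ≤ᵇ _} h)))

isOverpartitionAsc-atLeast : ∀ v b t → T (isOverpartitionAsc ((v , b) ∷ t)) → AllAtLeast v t
isOverpartitionAsc-atLeast v b []               _ = []
isOverpartitionAsc-atLeast v b ((v′ , b′) ∷ t) h =
  v≤v′ ∷ All.map (ℕₚ.≤-trans v≤v′) (isOverpartitionAsc-atLeast v′ b′ t (isOverpartitionAsc-tail (v , b) ((v′ , b′) ∷ t) h))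
  where
  v≤v′ : v ≤ v′
  v≤v′ = ℕₚ.≤ᵇ⇒≤ v v′ (proj₁ (∧-elim h))

isOverpartitionAsc-above : ∀ v t → T (isOverpartitionAsc ((v , true) ∷ t)) → AllAtLeast (suc v) t
isOverpartitionAsc-above v []               _ = []
isOverpartitionAsc-above v ((v′ , b′) ∷ t) h =
  v<v′ ∷ All.map (ℕₚ.≤-trans v<v′) (isOverpartitionAsc-atLeast v′ b′ t (isOverpartitionAsc-tail (v , true) ((v′ , b′) ∷ t) h))
  where
  v≤v′∧v≢v′ : T (v ≤ᵇ v′) × T (not (v ≡ᵇ v′) ∨ false)
  v≤v′∧v≢v′ with ∧-elim h
  ... | v≤v′ , rest = v≤v′ , proj₁ (∧-elim rest)
  v≢v′ : ¬ v ≡ v′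
  v≢v′ v≡v′ with ∨-elim {not (v ≡ᵇ v′)} (proj₂ v≤v′∧v≢v′)
  ... | inj₁ v≢ᵇv′ = not-elim v≢ᵇv′ (ℕₚ.≡⇒≡ᵇ v v′ v≡v′)
  v<v′ : v < v′
  v<v′ = ℕₚ.≤∧≢⇒< (ℕₚ.≤ᵇ⇒≤ v v′ (proj₁ v≤v′∧v≢v′)) v≢v′

isOverpartitionAsc-cons : ∀ v b t → AllAtLeast v t → (b ≡ true → AllAtLeast (suc v) t) →
  T (isOverpartitionAsc t) → T (isOverpartitionAsc ((v , b) ∷ t))
isOverpartitionAsc-cons v b     []               _          _     _ = tt
isOverpartitionAsc-cons v false ((v′ , b′) ∷ t) (v≤v′ ∷ _) _     h =
  ∧-intro (ℕₚ.≤⇒≤ᵇ v≤v′) (∧-intro (∨-introʳ {not (v ≡ᵇ v′)} tt) h)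
isOverpartitionAsc-cons v true  ((v′ , b′) ∷ t) (v≤v′ ∷ _) above h with above refl
... | v<v′ ∷ _ =
  ∧-intro (ℕₚ.≤⇒≤ᵇ v≤v′) (∧-intro (∨-introˡ (not-intro (λ v≡ᵇv′ → ℕₚ.<⇒≢ v<v′ (ℕₚ.≡ᵇ⇒≡ v v′ v≡ᵇv′)))) h)

olBelow-atLeast : ∀ v t → AllAtLeast v t → olBelow v t ≡ 0
olBelow-atLeast v []               _          = refl
olBelow-atLeast v ((u , false) ∷ t) (_ ∷ g)    = olBelow-atLeast v t g
olBelow-atLeast v ((u , true)  ∷ t) (v≤u ∷ g) with u <ᵇ v in u<ᵇv
... | true  = ⊥-elim (ℕₚ.<⇒≱ (ℕₚ.<ᵇ⇒< u v (Equivalence.from T-≡ u<ᵇv)) v≤u)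
... | false = olBelow-atLeast v t g

olBelow-first : ∀ v b t → AllAtLeast v t → olBelow v ((v , b) ∷ t) ≡ 0
olBelow-first v false t g = olBelow-atLeast v t g
olBelow-first v true  t g with v <ᵇ v in v<ᵇv
... | true  = ⊥-elim (ℕₚ.n≮n v (ℕₚ.<ᵇ⇒< v v (Equivalence.from T-≡ v<ᵇv)))
... | false = olBelow-atLeast v t g

olBelow-overlined : ∀ v u t → v < u → olBelow u ((v , true) ∷ t) ≡ suc (olBelow u t)
olBelow-overlined v u t v<u rewrite Equivalence.to T-≡ (ℕₚ.<⇒<ᵇ v<u) = refl

∸-suc-≤⇒ : ∀ n d o → n ∸ suc d ≤ o → n ∸ d ≤ suc o
∸-suc-≤⇒ zero    d       o _ rewrite ℕₚ.0∸n≡0 d = z≤n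
∸-suc-≤⇒ (suc n) zero    o h = s≤s h
∸-suc-≤⇒ (suc n) (suc d) o h = ∸-suc-≤⇒ n d o h

⇒∸-suc-≤ : ∀ n d o → n ∸ d ≤ suc o → n ∸ suc d ≤ o
⇒∸-suc-≤ zero    d       o _         rewrite ℕₚ.0∸n≡0 (suc d) = z≤n
⇒∸-suc-≤ (suc n) zero    o (s≤s h) = h
⇒∸-suc-≤ (suc n) (suc d) o h       = ⇒∸-suc-≤ n d o h

∸-≤-zero : ∀ {v d o} → v ≤ d → v ∸ d ≤ o
∸-≤-zero v≤d rewrite ℕₚ.m≤n⇒m∸n≡0 v≤d = z≤n

staircase-sound : ∀ w d m → T (staircase d m w) → Staircase d m w
staircase-sound []               d m _ = [] , tt , []
staircase-sound ((v , false) ∷ t) d m h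
  with ∧-elim {inRange m d v} h
... | range , rest with inRange-elim range | staircase-sound t d v rest
... | m≤v , v≤d | g , asc , enough =
  m≤v ∷ All.map (ℕₚ.≤-trans m≤v) g ,
  isOverpartitionAsc-cons v false t g (λ ()) asc ,
  ∸-≤-zero v≤d ∷ enough
staircase-sound ((v , true) ∷ t) d m h
  with ∧-elim {inRange m d v} h
... | range , rest with inRange-elim range | staircase-sound t (suc d) (suc v) rest
... | m≤v , v≤d | g , asc , enough =
  m≤v ∷ All.map (λ v<u → ℕₚ.≤-trans m≤v (ℕₚ.<⇒≤ v<u)) g ,
  isOverpartitionAsc-cons v true t (All.map ℕₚ.<⇒≤ g) (λ _ → g) asc ,
  ∸-≤-zero v≤d ∷ All.zipWith (λ {p} → raise {p}) (g , enough)
  where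
  -- the overlined part v adds one to the count below every later part
  raise : ∀ {p : ℕ × Bool} → suc v ≤ proj₁ p × proj₁ p ∸ suc d ≤ olBelow (proj₁ p) t →
          proj₁ p ∸ d ≤ olBelow (proj₁ p) ((v , true) ∷ t)
  raise {u , _} (v<u , h′) rewrite olBelow-overlined v u t v<u = ∸-suc-≤⇒ u d _ h′

staircase-complete : ∀ w d m → Staircase d m w → T (staircase d m w)
staircase-complete []            d m _ = tt
staircase-complete ((v , b) ∷ t) d m (m≤v ∷ _ , asc , v-enough ∷ enough) = byFlag b asc enough
  where
  g : AllAtLeast v t
  g = isOverpartitionAsc-atLeast v b t asc
  -- the first part has nothing below it, so v - d ≤ 0
  v≤d : v ≤ d
  v≤d = ℕₚ.m∸n≡0⇒m≤n (ℕₚ.n≤0⇒n≡0 (subst (λ o → v ∸ d ≤ o) (olBelow-first v b t g) v-enough))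
  byFlag : ∀ b → T (isOverpartitionAsc ((v , b) ∷ t)) →
           All (λ p → proj₁ p ∸ d ≤ olBelow (proj₁ p) ((v , b) ∷ t)) t → T (staircase d m ((v , b) ∷ t))
  byFlag false asc enough =
    ∧-intro (inRange-intro m≤v v≤d) (staircase-complete t d v (g , isOverpartitionAsc-tail _ t asc , enough))
  byFlag true asc enough =
    ∧-intro (inRange-intro m≤v v≤d) (staircase-complete t (suc d) (suc v) (g′ , isOverpartitionAsc-tail _ t asc ,
                                                                          All.zipWith (λ {p} → lower {p}) (g′ , enough)))
    where
    g′ : AllAtLeast (suc v) t
    g′ = isOverpartitionAsc-above v t asc
    -- removing the overlined part v lowers the count below every later part by one
    lower : ∀ {p : ℕ × Bool} → suc v ≤ proj₁ p × proj₁ p ∸ d ≤ olBelow (proj₁ p) ((v , true) ∷ t) →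
            proj₁ p ∸ suc d ≤ olBelow (proj₁ p) t
    lower {u , _} (v<u , h′) rewrite olBelow-overlined v u t v<u = ⇒∸-suc-≤ u d _ h′

adjacentAsc : ℕ × Bool → ℕ × Bool → Bool
adjacentAsc (a , x) (b , y) = (a ≤ᵇ b) ∧ (not (a ≡ᵇ b) ∨ not x)

firstAsc : ℕ × Bool → OverPart → Bool
firstAsc c []      = true
firstAsc c (e ∷ _) = adjacentAsc c e

isOverpartitionAsc-∷ : ∀ c z → isOverpartitionAsc (c ∷ z) ≡ firstAsc c z ∧ isOverpartitionAsc z
isOverpartitionAsc-∷ c       []               = refl
isOverpartitionAsc-∷ (a , x) ((b , y) ∷ z) = sym (∧-assoc (a ≤ᵇ b) (not (a ≡ᵇ b) ∨ not x) _)

firstAsc-++ : ∀ c u p q → firstAsc c (u ++ p ∷ q ∷ []) ≡ firstAsc c (u ++ p ∷ [])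
firstAsc-++ c []      p q = refl
firstAsc-++ c (e ∷ u) p q = refl

isOverpartitionAsc-snoc : ∀ u p q →
  isOverpartitionAsc (u ++ p ∷ q ∷ []) ≡ isOverpartitionAsc (u ++ p ∷ []) ∧ adjacentAsc p q
isOverpartitionAsc-snoc []      (a , x) (b , y) = cong ((a ≤ᵇ b) ∧_) (∧-identityʳ (not (a ≡ᵇ b) ∨ not x))
isOverpartitionAsc-snoc (c ∷ u) p q = begin
  isOverpartitionAsc (c ∷ u ++ p ∷ q ∷ [])
    ≡⟨ isOverpartitionAsc-∷ c (u ++ p ∷ q ∷ []) ⟩
  firstAsc c (u ++ p ∷ q ∷ []) ∧ isOverpartitionAsc (u ++ p ∷ q ∷ [])
    ≡⟨ cong₂ _∧_ (firstAsc-++ c u p q) (isOverpartitionAsc-snoc u p q) ⟩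
  firstAsc c (u ++ p ∷ []) ∧ (isOverpartitionAsc (u ++ p ∷ []) ∧ adjacentAsc p q)
    ≡⟨ sym (∧-assoc (firstAsc c (u ++ p ∷ [])) _ _) ⟩
  (firstAsc c (u ++ p ∷ []) ∧ isOverpartitionAsc (u ++ p ∷ [])) ∧ adjacentAsc p q
    ≡⟨ cong (_∧ adjacentAsc p q) (sym (isOverpartitionAsc-∷ c (u ++ p ∷ []))) ⟩
  isOverpartitionAsc (c ∷ u ++ p ∷ []) ∧ adjacentAsc p q ∎
  where open ≡-Reasoning

≡ᵇ-comm : ∀ a b → (a ≡ᵇ b) ≡ (b ≡ᵇ a)
≡ᵇ-comm a b = T-ext (λ h → ℕₚ.≡⇒≡ᵇ b a (sym (ℕₚ.≡ᵇ⇒≡ a b h))) (λ h → ℕₚ.≡⇒≡ᵇ a b (sym (ℕₚ.≡ᵇ⇒≡ b a h)))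

isOverpartition-reverse : ∀ w → isOverpartitionAsc (reverse w) ≡ isOverpartition w
isOverpartition-reverse []            = refl
isOverpartition-reverse (x ∷ [])      = refl
isOverpartition-reverse ((a , x) ∷ (b , y) ∷ t) = begin
  isOverpartitionAsc (reverse ((a , x) ∷ (b , y) ∷ t))
    ≡⟨ cong isOverpartitionAsc (trans (unfold-reverse (a , x) ((b , y) ∷ t))
                                       (cong (_++ [ (a , x) ]) (unfold-reverse (b , y) t))) ⟩
  isOverpartitionAsc ((reverse t ++ [ (b , y) ]) ++ [ (a , x) ])
    ≡⟨ cong isOverpartitionAsc (++-assoc (reverse t) [ (b , y) ] [ (a , x) ]) ⟩
  isOverpartitionAsc (reverse t ++ (b , y) ∷ (a , x) ∷ [])
    ≡⟨ isOverpartitionAsc-snoc (reverse t) (b , y) (a , x) ⟩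
  isOverpartitionAsc (reverse t ++ [ (b , y) ]) ∧ adjacentAsc (b , y) (a , x)
    ≡⟨ cong₂ _∧_ (trans (cong isOverpartitionAsc (sym (unfold-reverse (b , y) t))) (isOverpartition-reverse ((b , y) ∷ t)))
                 (cong (λ e → (b ≤ᵇ a) ∧ (not e ∨ not y)) (≡ᵇ-comm b a)) ⟩
  isOverpartition ((b , y) ∷ t) ∧ ((b ≤ᵇ a) ∧ (not (a ≡ᵇ b) ∨ not y))
    ≡⟨ trans (∧-comm (isOverpartition ((b , y) ∷ t)) _) (∧-assoc (b ≤ᵇ a) _ _) ⟩
  isOverpartition ((a , x) ∷ (b , y) ∷ t) ∎
  where open ≡-Reasoning

olBelow-↭ : ∀ v {xs ys} → xs ↭ ys → olBelow v xs ≡ olBelow v ys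
olBelow-↭ v Perm.refl              = refl
olBelow-↭ v (Perm.prep (u , b) p) = cong (λ n → if b ∧ (u <ᵇ v) then suc n else n) (olBelow-↭ v p)
olBelow-↭ v (Perm.swap (u , b) (u′ , b′) p) with b ∧ (u <ᵇ v) | b′ ∧ (u′ <ᵇ v)
... | true  | true  = cong (λ n → suc (suc n)) (olBelow-↭ v p)
... | true  | false = cong suc (olBelow-↭ v p)
... | false | true  = cong suc (olBelow-↭ v p)
... | false | false = olBelow-↭ v p
olBelow-↭ v (Perm.trans p p′)     = trans (olBelow-↭ v p) (olBelow-↭ v p′)

EnoughBelow-↭ : ∀ d {xs ys} → xs ↭ ys → EnoughBelow d xs → EnoughBelow d ys
EnoughBelow-↭ d p enough =
  All-resp-↭ p (All.map (λ {(v , _)} h → subst (λ o → v ∸ d ≤ o) (olBelow-↭ v p) h) enough)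

allᵇ⇒All : {A : Set} (p : A → Bool) (xs : List A) → T (allᵇ p xs) → All (λ x → T (p x)) xs
allᵇ⇒All p []       _ = []
allᵇ⇒All p (x ∷ xs) h with ∧-elim {p x} h
... | px , rest = px ∷ allᵇ⇒All p xs rest

All⇒allᵇ : {A : Set} (p : A → Bool) {xs : List A} → All (λ x → T (p x)) xs → T (allᵇ p xs)
All⇒allᵇ p []         = tt
All⇒allᵇ p (px ∷ pxs) = ∧-intro px (All⇒allᵇ p pxs)

occurs-All : {P : ℕ × Bool → Set} → ∀ v w → All P w → T (occurs v w) → Σ (ℕ × Bool) (λ p → proj₁ p ≡ v × P p)
occurs-All v (p ∷ w) (pp ∷ pw) occ with ∨-elim {proj₁ p ≡ᵇ v} occ
... | inj₁ here  = p , ℕₚ.≡ᵇ⇒≡ (proj₁ p) v here , pp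
... | inj₂ there = occurs-All v w pw there

occurs-parts : ∀ w → All (λ p → T (occurs (proj₁ p) w)) w
occurs-parts []      = []
occurs-parts (p ∷ w) =
  ∨-introˡ (ℕₚ.≡⇒≡ᵇ (proj₁ p) (proj₁ p) refl) ∷ All.map (∨-introʳ {proj₁ p ≡ᵇ _}) (occurs-parts w)

cond2-clause : ℕ → ℕ → OverPart → ℕ → Bool
cond2-clause j k w s = not ((1 ≤ᵇ s) ∧ occurs (j ∸ s) w) ∨ ((k ∸ s) ≤ᵇ olBelow (j ∸ s) w)

-- The clause with index s concerns the value v = k + d - s, which asks for k - s = v - d parts.
clause-demand : ∀ k d s → s ≤ k → ((k ℕ.+ d) ∸ s) ∸ d ≡ k ∸ s
clause-demand k d s s≤k = trans (cong (_∸ d) (ℕₚ.+-∸-comm d s≤k)) (ℕₚ.m+n∸n≡m (k ∸ s) d)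

clause-index : ∀ k d v → d < v → v < k ℕ.+ d →
  1 ≤ (k ℕ.+ d) ∸ v × (k ℕ.+ d) ∸ v < k × (k ℕ.+ d) ∸ ((k ℕ.+ d) ∸ v) ≡ v × k ∸ ((k ℕ.+ d) ∸ v) ≡ v ∸ d
clause-index k d v d<v v<k+d = 1≤s , s<k , ℕₚ.m∸[m∸n]≡n (ℕₚ.<⇒≤ v<k+d) , k∸s≡u
  where
  u : ℕ
  u = v ∸ d
  d+u≡v : d ℕ.+ u ≡ v
  d+u≡v = ℕₚ.m+[n∸m]≡n (ℕₚ.<⇒≤ d<v)
  u<k : u < k
  u<k = ℕₚ.+-cancelˡ-< d u k (subst (_< d ℕ.+ k) (sym d+u≡v) (subst (v <_) (ℕₚ.+-comm k d) v<k+d))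
  s≡k∸u : (k ℕ.+ d) ∸ v ≡ k ∸ u
  s≡k∸u = trans (cong ((k ℕ.+ d) ∸_) (sym d+u≡v))
                (trans (cong (_∸ (d ℕ.+ u)) (ℕₚ.+-comm k d)) (ℕₚ.[m+n]∸[m+o]≡n∸o d k u))
  1≤s : 1 ≤ (k ℕ.+ d) ∸ v
  1≤s = subst (1 ≤_) (sym s≡k∸u) (ℕₚ.m<n⇒0<n∸m u<k)
  s<k : (k ℕ.+ d) ∸ v < k
  s<k = subst (_< k) (sym s≡k∸u) (ℕₚ.∸-monoʳ-< (ℕₚ.m<n⇒0<n∸m d<v) (ℕₚ.<⇒≤ u<k))
  k∸s≡u : k ∸ ((k ℕ.+ d) ∸ v) ≡ u
  k∸s≡u = trans (cong (k ∸_) s≡k∸u) (ℕₚ.m∸[m∸n]≡n (ℕₚ.<⇒≤ u<k))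

-- `EnoughBelow d` implies condition (2) of O(·, k + d, k): each clause with
-- an occurring value is the demand of a part with that value.
EnoughBelow⇒cond2 : ∀ k d w → EnoughBelow d w → T (cond2 (k ℕ.+ d) k w)
EnoughBelow⇒cond2 k d w enough = All⇒allᵇ (cond2-clause (k ℕ.+ d) k w) (applyUpTo⁺₁ (λ s → s) k clause)
  where
  clause : ∀ {s} → s < k → T (cond2-clause (k ℕ.+ d) k w s)
  clause {s} s<k with T? (occurs ((k ℕ.+ d) ∸ s) w)
  ... | no ¬occ = ∨-introˡ (not-intro (λ h → ¬occ (proj₂ (∧-elim {1 ≤ᵇ s} h))))
  ... | yes occ with occurs-All ((k ℕ.+ d) ∸ s) w enough occ
  ... | _ , refl , demand =
    ∨-introʳ {not ((1 ≤ᵇ s) ∧ occurs ((k ℕ.+ d) ∸ s) w)}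
             (ℕₚ.≤⇒≤ᵇ (subst (_≤ olBelow ((k ℕ.+ d) ∸ s) w) (clause-demand k d s (ℕₚ.<⇒≤ s<k)) demand))

-- Condition (2) of O(·, k + d, k) implies `EnoughBelow d` when all parts are
-- below k + d: parts v ≤ d demand nothing, and a part d < v < k + d is
-- handled by the clause with index k + d - v.
cond2⇒EnoughBelow : ∀ k d w → All (λ p → proj₁ p < k ℕ.+ d) w → T (cond2 (k ℕ.+ d) k w) → EnoughBelow d w
cond2⇒EnoughBelow k d w bounded h = All.zipWith (λ {p} → part p) (bounded , occurs-parts w)
  where
  clauses : ∀ {s} → s < k → T (cond2-clause (k ℕ.+ d) k w s)
  clauses = applyUpTo⁻ (λ s → s) k (allᵇ⇒All (cond2-clause (k ℕ.+ d) k w) (upTo k) h)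
  granted : ∀ {s x} → (k ℕ.+ d) ∸ s ≡ x → T (cond2-clause (k ℕ.+ d) k w s) → 1 ≤ s → T (occurs x w) →
            k ∸ s ≤ olBelow x w
  granted {s} refl clause 1≤s occ with ∨-elim {not ((1 ≤ᵇ s) ∧ occurs ((k ℕ.+ d) ∸ s) w)} clause
  ... | inj₁ vacuous = ⊥-elim (not-elim vacuous (∧-intro (ℕₚ.≤⇒≤ᵇ 1≤s) occ))
  ... | inj₂ demand  = ℕₚ.≤ᵇ⇒≤ _ _ demand
  part : ∀ p → proj₁ p < k ℕ.+ d × T (occurs (proj₁ p) w) → proj₁ p ∸ d ≤ olBelow (proj₁ p) w
  part (v , _) (v<k+d , occ) with v ℕ.≤? d
  ... | yes v≤d = ∸-≤-zero v≤d
  ... | no  v≰d with clause-index k d v (ℕₚ.≰⇒> v≰d) v<k+d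
  ... | 1≤s , s<k , j∸s≡v , k∸s≡v∸d = subst (_≤ olBelow v w) k∸s≡v∸d (granted j∸s≡v (clauses s<k) 1≤s occ)

inO≡staircase : ∀ k d w → All (λ p → proj₁ p < k ℕ.+ d) w → inO (k ℕ.+ d) k w ≡ staircase d 0 (reverse w)
inO≡staircase k d w bounded = T-ext to from
  where
  to : T (inO (k ℕ.+ d) k w) → T (staircase d 0 (reverse w))
  to h with ∧-elim {isOverpartition w} h
  ... | op , c2 = staircase-complete (reverse w) d 0
    ( All.tabulate (λ _ → z≤n)
    , subst T (sym (isOverpartition-reverse w)) op
    , EnoughBelow-↭ d (↭-sym (↭-reverse w)) (cond2⇒EnoughBelow k d w bounded c2))
  from : T (staircase d 0 (reverse w)) → T (inO (k ℕ.+ d) k w)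
  from h with staircase-sound (reverse w) d 0 h
  ... | _ , asc , enough =
    ∧-intro (subst T (isOverpartition-reverse w) asc) (EnoughBelow⇒cond2 k d w (EnoughBelow-↭ d (↭-reverse w) enough))

module Weights (q : ℤ) (W : ℕ) where

  overline : ℤ
  overline = -1ℤ * q ^ W

  partWeight : ℕ × Bool → ℤ
  partWeight (v , false) = q ^ v
  partWeight (v , true)  = overline * q ^ v

  wordWeight : OverPart → ℤ
  wordWeight []      = 1ℤ
  wordWeight (x ∷ t) = partWeight x * wordWeight t

  wordWeight-signed : ∀ w → (-1ℤ ^ ol w) * q ^ (size w ℕ.+ ol w ℕ.* W) ≡ wordWeight w
  wordWeight-signed []               = refl
  wordWeight-signed ((v , false) ∷ t) = begin
    (-1ℤ ^ ol t) * q ^ (v ℕ.+ size t ℕ.+ ol t ℕ.* W)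
      ≡⟨ cong (λ n → (-1ℤ ^ ol t) * q ^ n) (ℕₚ.+-assoc v (size t) (ol t ℕ.* W)) ⟩
    (-1ℤ ^ ol t) * q ^ (v ℕ.+ (size t ℕ.+ ol t ℕ.* W))
      ≡⟨ cong ((-1ℤ ^ ol t) *_) (^-distribˡ-+-* q v _) ⟩
    (-1ℤ ^ ol t) * (q ^ v * q ^ (size t ℕ.+ ol t ℕ.* W))
      ≡⟨ rearrange (-1ℤ ^ ol t) (q ^ v) _ ⟩
    q ^ v * ((-1ℤ ^ ol t) * q ^ (size t ℕ.+ ol t ℕ.* W))
      ≡⟨ cong (q ^ v *_) (wordWeight-signed t) ⟩
    q ^ v * wordWeight t ∎
    where
    open ≡-Reasoning
    rearrange : ∀ s x y → s * (x * y) ≡ x * (s * y)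
    rearrange = solve-∀
  wordWeight-signed ((v , true) ∷ t) = begin
    (-1ℤ * -1ℤ ^ ol t) * q ^ (v ℕ.+ size t ℕ.+ (W ℕ.+ ol t ℕ.* W))
      ≡⟨ cong (λ n → (-1ℤ * -1ℤ ^ ol t) * q ^ n) (regroup v (size t) W (ol t)) ⟩
    (-1ℤ * -1ℤ ^ ol t) * q ^ (v ℕ.+ (W ℕ.+ (size t ℕ.+ ol t ℕ.* W)))
      ≡⟨ cong ((-1ℤ * -1ℤ ^ ol t) *_) (trans (^-distribˡ-+-* q v _) (cong (q ^ v *_) (^-distribˡ-+-* q W _))) ⟩
    (-1ℤ * -1ℤ ^ ol t) * (q ^ v * (q ^ W * q ^ (size t ℕ.+ ol t ℕ.* W)))
      ≡⟨ rearrange (-1ℤ ^ ol t) (q ^ v) (q ^ W) _ ⟩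
    overline * q ^ v * ((-1ℤ ^ ol t) * q ^ (size t ℕ.+ ol t ℕ.* W))
      ≡⟨ cong (overline * q ^ v *_) (wordWeight-signed t) ⟩
    overline * q ^ v * wordWeight t ∎
    where
    open ≡-Reasoning
    regroup : ∀ v s w o → v ℕ.+ s ℕ.+ (w ℕ.+ o ℕ.* w) ≡ v ℕ.+ (w ℕ.+ (s ℕ.+ o ℕ.* w))
    regroup = ℕ-Solver.solve-∀
    rearrange : ∀ s x z y → (-1ℤ * s) * (x * (z * y)) ≡ (-1ℤ * z * x) * (s * y)
    rearrange = solve-∀

  wordWeight-↭ : ∀ {xs ys} → xs ↭ ys → wordWeight xs ≡ wordWeight ys
  wordWeight-↭ Perm.refl          = refl
  wordWeight-↭ (Perm.prep x p)     = cong (partWeight x *_) (wordWeight-↭ p)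
  wordWeight-↭ (Perm.swap x y p)   =
    trans (cong (λ r → partWeight x * (partWeight y * r)) (wordWeight-↭ p)) (exchange (partWeight x) (partWeight y) _)
    where
    exchange : ∀ a b r → a * (b * r) ≡ b * (a * r)
    exchange = solve-∀
  wordWeight-↭ (Perm.trans p p′)  = trans (wordWeight-↭ p) (wordWeight-↭ p′)

module StaircaseSum (q : ℤ) (W : ℕ) (j : ℕ) where
  open Weights q W

  S : ℕ → ℕ → ℕ → ℤ
  S k d m = sumWords k (choices j) (λ w → if staircase d m w then wordWeight w else 0ℤ)

  closedForm : ℕ → ℕ → ℕ → ℤ
  closedForm k d m = q ^ (k ℕ.* m) * poch (q ^ W) q k * gauss q (k ℕ.+ (d ∸ m)) k

  S-firstPart : ∀ k d m → S (suc k) d m ≡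
    sumOver (upTo j) (λ v → if inRange m d v then q ^ v * S k d v + overline * q ^ v * S k (suc d) (suc v) else 0ℤ)
  S-firstPart k d m = begin
    S (suc k) d m
      ≡⟨ sumWords-head k (choices j) _ ⟩
    sumOver (choices j) (λ x → sumWords k (choices j) (λ u → if staircase d m (x ∷ u) then partWeight x * wordWeight u else 0ℤ))
      ≡⟨ sumOver-concatMap _ (upTo j) _ ⟩
    sumOver (upTo j) (λ v → plain v + (overlined v + 0ℤ))
      ≡⟨ sumOver-cong (upTo j) (λ v → cong₂ _+_ (plain-guard v) (cong (_+ 0ℤ) (overlined-guard v))) ⟩
    sumOver (upTo j) (λ v → (if inRange m d v then q ^ v * S k d v else 0ℤ)
                           + ((if inRange m d v then overline * q ^ v * S k (suc d) (suc v) else 0ℤ) + 0ℤ))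
      ≡⟨ sumOver-cong (upTo j) (λ v → merge (inRange m d v) _ _) ⟩
    sumOver (upTo j) (λ v → if inRange m d v then q ^ v * S k d v + overline * q ^ v * S k (suc d) (suc v) else 0ℤ) ∎
    where
    open ≡-Reasoning
    plain overlined : ℕ → ℤ
    plain v = sumWords k (choices j) (λ u → if staircase d m ((v , false) ∷ u) then q ^ v * wordWeight u else 0ℤ)
    overlined v = sumWords k (choices j) (λ u → if staircase d m ((v , true) ∷ u) then overline * q ^ v * wordWeight u else 0ℤ)
    plain-guard : ∀ v → plain v ≡ (if inRange m d v then q ^ v * S k d v else 0ℤ)
    plain-guard v = sumOver-guard (words k (choices j)) (inRange m d v) (staircase d v) (q ^ v) wordWeight
    overlined-guard : ∀ v → overlined v ≡ (if inRange m d v then overline * q ^ v * S k (suc d) (suc v) else 0ℤ)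
    overlined-guard v = sumOver-guard (words k (choices j)) (inRange m d v) (staircase (suc d) (suc v)) (overline * q ^ v) wordWeight
    merge : ∀ g a b → (if g then a else 0ℤ) + ((if g then b else 0ℤ) + 0ℤ) ≡ (if g then a + b else 0ℤ)
    merge true  a b = cong (a +_) (+-identityʳ b)
    merge false a b = refl

  -- The two first-part contributions combine by the defining recursion of (q^W;q)_(k+1).
  firstPart-closedForm : ∀ k D v →
    q ^ v * closedForm k D v + overline * q ^ v * closedForm k (suc D) (suc v)
      ≡ poch (q ^ W) q (suc k) * (q ^ (suc k ℕ.* v) * gauss q (k ℕ.+ (D ∸ v)) k)
  firstPart-closedForm k D v = begin
    q ^ v * (q ^ (k ℕ.* v) * P * G) + overline * q ^ v * (q ^ (k ℕ.* suc v) * P * G)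
      ≡⟨ cong (λ z → q ^ v * (q ^ (k ℕ.* v) * P * G) + overline * q ^ v * (z * P * G))
              (trans (cong (q ^_) (ℕₚ.*-suc k v)) (^-distribˡ-+-* q k (k ℕ.* v))) ⟩
    q ^ v * (q ^ (k ℕ.* v) * P * G) + overline * q ^ v * (q ^ k * q ^ (k ℕ.* v) * P * G)
      ≡⟨ combine (q ^ v) (q ^ (k ℕ.* v)) P G (q ^ W) (q ^ k) ⟩
    P * (1ℤ - q ^ W * q ^ k) * (q ^ v * q ^ (k ℕ.* v) * G)
      ≡⟨ cong (λ z → P * (1ℤ - q ^ W * q ^ k) * (z * G)) (sym (^-distribˡ-+-* q v (k ℕ.* v))) ⟩
    poch (q ^ W) q (suc k) * (q ^ (suc k ℕ.* v) * G) ∎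
    where
    open ≡-Reasoning
    P G : ℤ
    P = poch (q ^ W) q k
    G = gauss q (k ℕ.+ (D ∸ v)) k
    combine : ∀ x y p g w z → x * (y * p * g) + -1ℤ * w * x * (z * y * p * g) ≡ p * (1ℤ - w * z) * (x * y * g)
    combine = solve-∀

  -- The staircase sum has the closed form, as long as all letters it can use are available.
  S≡closedForm : ∀ k d m → m ≤ d → d ℕ.+ k ≤ j → S k d m ≡ closedForm k d m
  S≡closedForm zero    d m _   _ = refl
  S≡closedForm (suc k) d m m≤d d+k<j with ℕₚ.m≤n⇒∃[o]m+o≡n m≤d
  ... | e , refl = begin
    S (suc k) (m ℕ.+ e) m
      ≡⟨ S-firstPart k (m ℕ.+ e) m ⟩
    sumOver (upTo j) (λ v → if inRange m (m ℕ.+ e) v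
                              then q ^ v * S k (m ℕ.+ e) v + overline * q ^ v * S k (suc (m ℕ.+ e)) (suc v) else 0ℤ)
      ≡⟨ sumOver-cong (upTo j) byInduction ⟩
    sumOver (upTo j) (λ v → if inRange m (m ℕ.+ e) v then P′ * H v else 0ℤ)
      ≡⟨ sumUpTo-inRange j m e (λ v → P′ * H v) (ℕₚ.<-≤-trans (ℕₚ.m<m+n (m ℕ.+ e) (s≤s z≤n)) d+k<j) ⟩
    intervalSum (λ v → P′ * H v) m e
      ≡⟨ intervalSum-scale P′ H m e ⟩
    P′ * intervalSum H m e
      ≡⟨ cong (P′ *_) (hockeyStick q k (m ℕ.+ e) e m refl) ⟩
    P′ * (q ^ (suc k ℕ.* m) * gauss q (suc k ℕ.+ e) (suc k))
      ≡⟨ reorder P′ (q ^ (suc k ℕ.* m)) _ ⟩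
    q ^ (suc k ℕ.* m) * P′ * gauss q (suc k ℕ.+ e) (suc k)
      ≡⟨ cong (λ n → q ^ (suc k ℕ.* m) * P′ * gauss q (suc k ℕ.+ n) (suc k)) (sym (ℕₚ.m+n∸m≡n m e)) ⟩
    closedForm (suc k) (m ℕ.+ e) m ∎
    where
    open ≡-Reasoning
    D : ℕ
    D = m ℕ.+ e
    P′ : ℤ
    P′ = poch (q ^ W) q (suc k)
    H : ℕ → ℤ
    H v = q ^ (suc k ℕ.* v) * gauss q (k ℕ.+ (D ∸ v)) k
    reorder : ∀ p x g → p * (x * g) ≡ x * p * g
    reorder = solve-∀
    byInduction : ∀ v → (if inRange m D v then q ^ v * S k D v + overline * q ^ v * S k (suc D) (suc v) else 0ℤ)
                        ≡ (if inRange m D v then P′ * H v else 0ℤ)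
    byInduction v with inRange m D v in range
    ... | false = refl
    ... | true  = trans (cong₂ (λ x y → q ^ v * x + overline * q ^ v * y)
                               (S≡closedForm k D v v≤D (ℕₚ.≤-trans (ℕₚ.+-monoʳ-≤ D (ℕₚ.n≤1+n k)) d+k<j))
                               (S≡closedForm k (suc D) (suc v) (s≤s v≤D) (subst (_≤ j) (ℕₚ.+-suc D k) d+k<j)))
                        (firstPart-closedForm k D v)
      where
      v≤D : v ≤ D
      v≤D = proj₂ (inRange-elim {m} (Equivalence.from T-≡ range))

choices-bounded : ∀ j → All (λ p → proj₁ p < j) (choices j)
choices-bounded j = concat⁺ (map⁺ (All.map (λ v<j → v<j ∷ v<j ∷ []) (all-upTo j)))

summand : (q : ℤ) (W i k d : ℕ) →
  sumO (k ℕ.+ d) k (λ w → (-1ℤ ^ ol w) * q ^ (size w ℕ.+ ol w ℕ.* W) * q ^ ((i ∸ length w) ℕ.* ((k ℕ.+ d) ∸ length w)))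
    ≡ poch (q ^ W) q k * gauss q (k ℕ.+ d) k * q ^ ((i ∸ k) ℕ.* ((k ℕ.+ d) ∸ k))
summand q W i k d = begin
  sumOver (words k letters) (λ w → if inO (k ℕ.+ d) k w then F w else 0ℤ)
    ≡⟨ sumOver-congᴬ (words k letters) (words-shape k letters (choices-bounded (k ℕ.+ d))) toStaircase ⟩
  sumOver (words k letters) (λ w → C * h (reverse w))
    ≡⟨ sumOver-scale (words k letters) C _ ⟩
  C * sumWords k letters (λ w → h (reverse w))
    ≡⟨ cong (C *_) (sumWords-reverse k letters h) ⟩
  C * S k d 0
    ≡⟨ cong (C *_) (S≡closedForm k d 0 z≤n (ℕₚ.≤-reflexive (ℕₚ.+-comm d k))) ⟩
  C * (q ^ (k ℕ.* 0) * poch (q ^ W) q k * gauss q (k ℕ.+ d) k)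
    ≡⟨ cong (λ n → C * (q ^ n * poch (q ^ W) q k * gauss q (k ℕ.+ d) k)) (ℕₚ.*-zeroʳ k) ⟩
  C * (1ℤ * poch (q ^ W) q k * gauss q (k ℕ.+ d) k)
    ≡⟨ cong (λ z → C * (z * gauss q (k ℕ.+ d) k)) (*-identityˡ (poch (q ^ W) q k)) ⟩
  C * (poch (q ^ W) q k * gauss q (k ℕ.+ d) k)
    ≡⟨ *-comm C _ ⟩
  poch (q ^ W) q k * gauss q (k ℕ.+ d) k * C ∎
  where
  open ≡-Reasoning
  open Weights q W
  open StaircaseSum q W (k ℕ.+ d)
  letters : List (ℕ × Bool)
  letters = choices (k ℕ.+ d)
  C : ℤ
  C = q ^ ((i ∸ k) ℕ.* ((k ℕ.+ d) ∸ k))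
  F : OverPart → ℤ
  F w = (-1ℤ ^ ol w) * q ^ (size w ℕ.+ ol w ℕ.* W) * q ^ ((i ∸ length w) ℕ.* ((k ℕ.+ d) ∸ length w))
  h : OverPart → ℤ
  h w = if staircase d 0 w then wordWeight w else 0ℤ
  toStaircase : ∀ w → length w ≡ k × All (λ p → proj₁ p < k ℕ.+ d) w →
                (if inO (k ℕ.+ d) k w then F w else 0ℤ) ≡ C * h (reverse w)
  toStaircase w (refl , bounded) rewrite inO≡staircase k d w bounded with staircase d 0 (reverse w)
  ... | false = sym (*-zeroʳ C)
  ... | true  = trans (*-comm _ C)
                      (cong (C *_) (trans (wordWeight-signed w) (wordWeight-↭ (↭-sym (↭-reverse w)))))

-- The theorem holds summand by summand.
theorem2p2 : (i j : ℕ) → j ≤ i → (q : ℤ) → LHS i j q ≡ RHS i j q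
theorem2p2 i j _ q = sumOver-congᴬ (upTo (suc j)) (all-upTo (suc j)) (λ k k<1+j → termwise k (ℕₚ.≤-pred k<1+j))
  where
  termwise : ∀ k → k ≤ j →
    poch (q ^ suc (i ∸ k)) q k * gauss q j k * q ^ ((i ∸ k) ℕ.* (j ∸ k))
      ≡ sumO j k (λ w → (-1ℤ ^ ol w) * q ^ (size w ℕ.+ ol w ℕ.* weight i k) * q ^ ((i ∸ length w) ℕ.* (j ∸ length w)))
  termwise k k≤j with ℕₚ.m≤n⇒∃[o]m+o≡n k≤j
  ... | d , refl = sym (summand q (weight i k) i k d)
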